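{- Let $k\in\mathbb{N}$ with $k\ge 3$, $a\in\mathbb{Z}$, and let $\{\pi_i\}_{i=2}^k$ (distinct odd primes) be a balanced covering of $\langle a\rangle_{\Omega(k)}$. Then $\pi_i\le q_k$ for all $i=2,\dots,k$, where $$q_k=\max\{p \text{ prime} \mid p\le p_k \ \text{or}\ p\le \Omega(k-1)+1\}.$$
   Context: $p_k$ denotes the $k$-th prime ($p_1=2$). For $a\in\mathbb{Z}$, $m\in\mathbb{N}$, $\langle a\rangle_m=(a+1,\dots,a+m)$. A set of primes $\{\pi_i\}$ covers $\langle a\rangle_m$ if each $a+x$, $1\le x\le m$, is divisible by some $\pi_i$. For $k\ge 2$, $\Omega(k)$ is the maximum $m\in\mathbb{N}$ for which there exist $a\in\mathbb{Z}$ and $k-1$ distinct odd primes covering $\langle a\rangle_m$. For $k\ge3$, a covering $\{\pi_i\}_{i=2}^k$ (distinct odd primes) of $\langle a\rangle_m$ is called balanced if $m=\Omega(k)$ and for every $j\in\{2,\dots,k\}$ with $\pi_j>p_k$ there exist $x,y$ with $1\le x<y\le m$ such that $\pi_j\mid a+x$, $\pi_j\mid a+y$, and $\pi_i\nmid a+x$, $\pi_i\nmid a+y$ for all $i\in\{2,\dots,k\}$, $i\neq j$. -}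

module Defs where

open import Data.Nat using (ℕ; zero; suc; _+_; _∸_; _≤_; _<_; _⊔_)
open import Data.Nat.Primality using (Prime; prime?)
open import Data.Nat.Divisibility using () renaming (_∣_ to _∣ℕ_)
open import Data.Integer using (ℤ; +_) renaming (_+_ to _+ℤ_)
open import Data.Integer.Divisibility using (_∣_)
open import Data.Fin using (Fin)
open import Data.List using (List; filter; upTo; length)
open import Data.Sum using (_⊎_)
open import Data.Product using (Σ; ∃; _×_)
open import Relation.Binary.PropositionalEquality using (_≡_; _≢_)
open import Relation.Nullary using (¬_)
open import Function.Definitions using (Injective)

primesBelow : ℕ → ℕ
primesBelow n = length (filter prime? (upTo n))

-- IsNthPrime k p : p is the k-th prime p_k (p_1 = 2)
IsNthPrime : ℕ → ℕ → Set
IsNthPrime k p = Prime p × suc (primesBelow p) ≡ k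

-- A family of k-1 primes π_2,…,π_k, indexed by Fin (k ∸ 1)
Family : ℕ → Set
Family k = Fin (k ∸ 1) → ℕ

DistinctOddPrimes : (k : ℕ) → Family k → Set
DistinctOddPrimes k π =
  Injective _≡_ _≡_ π × (∀ i → Prime (π i) × π i ≢ 2)

Covers : (k : ℕ) → ℤ → ℕ → Family k → Set
Covers k a m π = ∀ x → 1 ≤ x → x ≤ m → ∃ λ i → (+ π i) ∣ (a +ℤ + x)

Attainable : ℕ → ℕ → Set
Attainable k m = Σ ℤ λ a → Σ (Family k) λ π → DistinctOddPrimes k π × Covers k a m π

IsOmega : ℕ → ℕ → Set
IsOmega k m = Attainable k m × (∀ m' → Attainable k m' → m' ≤ m)

Balanced : (k : ℕ) → ℤ → ℕ → Family k → Set
Balanced k a m π =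
  DistinctOddPrimes k π × Covers k a m π × IsOmega k m ×
  (∀ pk → IsNthPrime k pk → ∀ j → pk < π j →
     Σ ℕ λ x → Σ ℕ λ y → 1 ≤ x × x < y × y ≤ m ×
       (+ π j) ∣ (a +ℤ + x) × (+ π j) ∣ (a +ℤ + y) ×
       (∀ i → i ≢ j → ¬ ((+ π i) ∣ (a +ℤ + x)) × ¬ ((+ π i) ∣ (a +ℤ + y))))

IsQ : ℕ → ℕ → Set
IsQ k q = ∀ pk w → IsNthPrime k pk → IsOmega (k ∸ 1) w →
          Prime q × (q ≤ pk ⊎ q ≤ w + 1) ×
          (∀ p → Prime p → (p ≤ pk ⊎ p ≤ w + 1) → p ≤ q)

module Submission where

-- Let π_i belong to a balanced covering. If π_i ≤ p_k, then π_i ≤ q_k by the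
-- maximality of q_k. Otherwise balancedness provides x < y in the block with
-- π_i ∣ a + x and π_i ∣ a + y, so π_i ≤ y − x. The π_i − 1 integers
-- a + x + 1, …, a + x + π_i − 1 then lie in the block and none of them is a
-- multiple of π_i, so the remaining k − 2 primes cover them: Ω(k−1) ≥ π_i − 1,
-- i.e. π_i ≤ Ω(k−1) + 1 ≤ q_k.
--
-- Two existence facts are needed to instantiate q_k, whose definition quantifies
-- over p_k and Ω(k−1): the k-th prime exists (Euclid, via a prime factor of
-- N! + 1), and Ω(k−1) exists. The latter is only available up to double
-- negation, as the greatest attainable length below the bound Ω(k) (adding a
-- fresh large prime shows Ω(k−1) ≤ Ω(k)); since the conclusion π_i ≤ q_k is
-- decidable, this suffices.

open import Defs
open import Data.Nat using (ℕ; zero; suc; _+_; _∸_; _≤_; _<_; _!; _≤?_; _<?_; z≤n; s≤s; s≤s⁻¹)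
open import Data.Nat using (>-nonZero; nonTrivial⇒n>1)
open import Data.Nat.Properties
open import Data.Nat.Primality using (Prime; prime?; prime⇒nonZero; prime⇒nonTrivial)
open import Data.Nat.Divisibility using (∣1⇒≡1; ∣m+n∣m⇒∣n; m∣m*n; m≤n⇒m!∣n!; ∣-trans; ∣⇒≤)
  renaming (_∣_ to _∣ℕ_)
open import Data.Nat.Primality.Factorisation using (factorise)
open import Data.Nat.ListAction using (product)
open import Data.Integer using (ℤ; +_) renaming (_+_ to _+ℤ_)
open import Data.Integer.Properties using () renaming (+-assoc to +ℤ-assoc)
open import Data.Integer.Divisibility using (_∣_)
import Data.Integer.Divisibility.Signed as Signed
open import Data.Fin using (Fin; punchIn; punchOut) renaming (zero to fzero; suc to fsuc; _≟_ to _≟ᶠ_)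
open import Data.Fin.Properties using (punchIn-injective)
open import Data.Vec.Functional using (removeAt; foldr) renaming (_∷_ to _∷ᶠ_)
open import Data.Vec.Functional.Properties using (removeAt-punchOut)
open import Data.List using ([]; _∷_; [_]; _++_; filter; upTo; length)
open import Data.List.Properties using (upTo-∷ʳ; filter-++; filter-accept; filter-reject; length-++)
open import Data.List.Relation.Unary.All using (_∷_)
open import Data.Sum using (_⊎_; inj₁; inj₂)
open import Data.Product using (∃; _×_; _,_; proj₁; proj₂)
open import Data.Empty using (⊥-elim)
open import Function using (_∘_)
open import Function.Definitions using (Injective)
open import Relation.Binary.PropositionalEquality using (_≡_; _≢_; refl; sym; trans; cong; subst; module ≡-Reasoning)
open import Relation.Nullary using (¬_; yes; no)
open import Relation.Nullary.Negation using (¬¬-map)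
open import Relation.Nullary.Decidable using (decidable-stable; ¬¬-excluded-middle)

primesBelow-suc : ∀ n → primesBelow (suc n) ≡ primesBelow n + length (filter prime? [ n ])
primesBelow-suc n = begin
  length (filter prime? (upTo (suc n)))                  ≡⟨ cong (length ∘ filter prime?) (sym (upTo-∷ʳ n)) ⟩
  length (filter prime? (upTo n ++ [ n ]))               ≡⟨ cong length (filter-++ prime? (upTo n) [ n ]) ⟩
  length (filter prime? (upTo n) ++ filter prime? [ n ]) ≡⟨ length-++ (filter prime? (upTo n)) ⟩
  primesBelow n + length (filter prime? [ n ])           ∎
  where open ≡-Reasoning

primesBelow-prime : ∀ {n} → Prime n → primesBelow (suc n) ≡ suc (primesBelow n)
primesBelow-prime {n} pn = begin
  primesBelow (suc n)                          ≡⟨ primesBelow-suc n ⟩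
  primesBelow n + length (filter prime? [ n ]) ≡⟨ cong (λ l → primesBelow n + length l) (filter-accept prime? pn) ⟩
  primesBelow n + 1                            ≡⟨ +-comm (primesBelow n) 1 ⟩
  suc (primesBelow n)                          ∎
  where open ≡-Reasoning

primesBelow-nonprime : ∀ {n} → ¬ Prime n → primesBelow (suc n) ≡ primesBelow n
primesBelow-nonprime {n} ¬pn = begin
  primesBelow (suc n)                          ≡⟨ primesBelow-suc n ⟩
  primesBelow n + length (filter prime? [ n ]) ≡⟨ cong (λ l → primesBelow n + length l) (filter-reject prime? ¬pn) ⟩
  primesBelow n + 0                            ≡⟨ +-identityʳ (primesBelow n) ⟩
  primesBelow n                                ∎
  where open ≡-Reasoning

primesBelow-mono : ∀ {m n} → m ≤ n → primesBelow m ≤ primesBelow n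
primesBelow-mono {n = zero} z≤n = ≤-refl
primesBelow-mono {m} {suc n} m≤1+n with m≤n⇒m<n∨m≡n m≤1+n
... | inj₂ refl = ≤-refl
... | inj₁ m<1+n = ≤-trans (primesBelow-mono (s≤s⁻¹ m<1+n))
                           (subst (primesBelow n ≤_) (sym (primesBelow-suc n)) (m≤m+n _ _))

prime⇒≥2 : ∀ {p} → Prime p → 2 ≤ p
prime⇒≥2 {p} pp = nonTrivial⇒n>1 p {{prime⇒nonTrivial pp}}

∣-factorial : ∀ {d N} → 1 ≤ d → d ≤ N → d ∣ℕ N !
∣-factorial {suc d} _ d≤N = ∣-trans (m∣m*n (d !)) (m≤n⇒m!∣n! d≤N)

-- Euclid: a prime factor of N! + 1 exceeds N, since every 1 ≤ d ≤ N divides N!.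
prime-above : ∀ N → ∃ λ p → Prime p × N < p
prime-above N with factorise (suc (N !))
... | record { factors = [] ; isFactorisation = N!+1≡1 } =
  ⊥-elim (<⇒≢ (1≤n! N) (sym (suc-injective N!+1≡1)))
... | record { factors = p ∷ ps ; isFactorisation = N!+1≡p*_ ; factorsPrime = pp ∷ _ } with N <? p
...   | yes N<p = p , pp , N<p
...   | no N≮p = ⊥-elim (<⇒≢ (prime⇒≥2 pp) (sym (∣1⇒≡1 (∣m+n∣m⇒∣n p∣N!+1 p∣N!))))
  where
  p∣N!+1 : p ∣ℕ N ! + 1
  p∣N!+1 = subst (p ∣ℕ_) (trans (sym N!+1≡p*_) (+-comm 1 (N !))) (m∣m*n (product ps))
  p∣N! : p ∣ℕ N !
  p∣N! = ∣-factorial (≤-trans (s≤s z≤n) (prime⇒≥2 pp)) (≮⇒≥ N≮p)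

primesBelow-unbounded : ∀ k → ∃ λ N → k ≤ primesBelow N
primesBelow-unbounded zero = 0 , z≤n
primesBelow-unbounded (suc k) with primesBelow-unbounded k
... | N , k≤ with prime-above N
...   | p , pp , N<p = suc p , subst (suc k ≤_) (sym (primesBelow-prime pp))
                                     (s≤s (≤-trans k≤ (primesBelow-mono (<⇒≤ N<p))))

-- The least N with k ≤ primesBelow N is p_k + 1; searching downwards from any such N finds p_k.
nthPrime-below : ∀ k N → 1 ≤ k → k ≤ primesBelow N → ∃ (IsNthPrime k)
nthPrime-below k zero 1≤k k≤0 = ⊥-elim (<⇒≱ 1≤k k≤0)
nthPrime-below k (suc N) 1≤k k≤ with k ≤? primesBelow N | prime? N
... | yes k≤′ | _ = nthPrime-below k N 1≤k k≤′
... | no k≰ | yes pN = N , pN , ≤-antisym (≰⇒> k≰) (subst (k ≤_) (primesBelow-prime pN) k≤)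
... | no k≰ | no ¬pN = ⊥-elim (k≰ (subst (k ≤_) (primesBelow-nonprime ¬pN) k≤))

nthPrime : ∀ k → 1 ≤ k → ∃ (IsNthPrime k)
nthPrime k 1≤k with primesBelow-unbounded k
... | N , k≤ = nthPrime-below k N 1≤k k≤

∣-difference : ∀ p b t → + p ∣ b → + p ∣ b +ℤ + t → p ∣ℕ t
∣-difference p b t p∣b p∣b+t =
  Signed.∣⇒∣ᵤ (Signed.∣m+n∣m⇒∣n (Signed.∣ᵤ⇒∣ {+ p} {b +ℤ + t} p∣b+t) (Signed.∣ᵤ⇒∣ {+ p} {b} p∣b))

multiples-apart : ∀ p b d → 0 < d → + p ∣ b → + p ∣ b +ℤ + d → p ≤ d
multiples-apart p b d 0<d p∣b p∣b+d = ∣⇒≤ {{>-nonZero 0<d}} (∣-difference p b d p∣b p∣b+d)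

no-multiple-between : ∀ p b t → + p ∣ b → 0 < t → t < p → ¬ (+ p ∣ b +ℤ + t)
no-multiple-between p b t p∣b 0<t t<p p∣b+t = <⇒≱ t<p (multiples-apart p b t 0<t p∣b p∣b+t)

covers-shift : ∀ k a m (π : Family k) x l → x + l ≤ m → Covers k a m π → Covers k (a +ℤ + x) l π
covers-shift k a m π x l x+l≤m covers t 1≤t t≤l
  with i , π∣ ← covers (x + t) (≤-trans 1≤t (m≤n+m t x)) (≤-trans (+-monoʳ-≤ x t≤l) x+l≤m)
  = i , subst (+ π i ∣_) (sym (+ℤ-assoc a (+ x) (+ t))) π∣

covers-removeAt : ∀ n a m (π : Family (suc (suc n))) i →
                  (∀ t → 1 ≤ t → t ≤ m → ¬ (+ π i ∣ a +ℤ + t)) →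
                  Covers (suc (suc n)) a m π → Covers (suc n) a m (removeAt π i)
covers-removeAt n a m π i avoids covers t 1≤t t≤m with covers t 1≤t t≤m
... | j , π∣ with i ≟ᶠ j
...   | yes refl = ⊥-elim (avoids t 1≤t t≤m π∣)
...   | no i≢j = punchOut i≢j , subst (λ p → + p ∣ a +ℤ + t) (sym (removeAt-punchOut π i≢j)) π∣

removeAt-distinct : ∀ n (π : Family (suc (suc n))) i →
                    DistinctOddPrimes (suc (suc n)) π → DistinctOddPrimes (suc n) (removeAt π i)
removeAt-distinct n π i (injective , oddPrime) =
  (λ eq → punchIn-injective i _ _ (injective eq)) , oddPrime ∘ punchIn i

-- The sum of a finite family bounds each of its entries; it is used to find a
-- prime different from all members of a family.
sum : ∀ {n} → (Fin n → ℕ) → ℕ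
sum = foldr _+_ 0

entry≤sum : ∀ {n} (f : Fin n → ℕ) i → f i ≤ sum f
entry≤sum f fzero = m≤m+n _ _
entry≤sum f (fsuc i) = ≤-trans (entry≤sum (f ∘ fsuc) i) (m≤n+m _ (f fzero))

-- Prepending a prime larger than 2 and all members keeps a covering family
-- distinct and odd; so any length attainable with k primes is attainable with
-- k + 1, i.e. Ω is nondecreasing.
attainable-suc : ∀ n m → Attainable (suc n) m → Attainable (suc (suc n)) m
attainable-suc n m (a , π , (injective , oddPrime) , covers)
  with p , pp , sum+2<p ← prime-above (sum π + 2)
  = a , p ∷ᶠ π , (injective′ , oddPrime′) , λ x 1≤x x≤m → let i , π∣ = covers x 1≤x x≤m in fsuc i , π∣
  where
  fresh : ∀ j → π j < p
  fresh j = ≤-<-trans (≤-trans (entry≤sum π j) (m≤m+n _ 2)) sum+2<p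
  injective′ : Injective _≡_ _≡_ (p ∷ᶠ π)
  injective′ {fzero} {fzero} _ = refl
  injective′ {fzero} {fsuc j} eq = ⊥-elim (<⇒≢ (fresh j) (sym eq))
  injective′ {fsuc i} {fzero} eq = ⊥-elim (<⇒≢ (fresh i) eq)
  injective′ {fsuc i} {fsuc j} eq = cong fsuc (injective eq)
  oddPrime′ : ∀ i → Prime ((p ∷ᶠ π) i) × (p ∷ᶠ π) i ≢ 2
  oddPrime′ fzero = pp , λ p≡2 → <⇒≢ (≤-<-trans (m≤n+m 2 (sum π)) sum+2<p) (sym p≡2)
  oddPrime′ (fsuc j) = oddPrime j

-- If a prime π i of a covering of ⟨a⟩_m divides both a + x and a + y with
-- x < y ≤ m, the other primes cover the π i − 1 integers following a + x.
gap-attainable : ∀ n a m (π : Family (suc (suc n))) i x y →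
                 DistinctOddPrimes (suc (suc n)) π → Covers (suc (suc n)) a m π →
                 x < y → y ≤ m → + π i ∣ a +ℤ + x → + π i ∣ a +ℤ + y →
                 Attainable (suc n) (π i ∸ 1)
gap-attainable n a m π i x y distinct covers x<y y≤m π∣x π∣y =
  a +ℤ + x , removeAt π i , removeAt-distinct n π i distinct ,
  covers-removeAt n (a +ℤ + x) (π i ∸ 1) π i avoids
    (covers-shift (suc (suc n)) a m π x (π i ∸ 1) x+πi∸1≤m covers)
  where
  instance
    πi≢0 = prime⇒nonZero (proj₁ (proj₂ distinct i))
  d = y ∸ x
  y≡x+d : a +ℤ + y ≡ (a +ℤ + x) +ℤ + d
  y≡x+d = begin
    a +ℤ + y             ≡⟨ cong (λ z → a +ℤ + z) (sym (m+[n∸m]≡n (<⇒≤ x<y))) ⟩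
    a +ℤ (+ x +ℤ + d)    ≡⟨ sym (+ℤ-assoc a (+ x) (+ d)) ⟩
    (a +ℤ + x) +ℤ + d    ∎
    where open ≡-Reasoning
  πi≤d : π i ≤ d
  πi≤d = multiples-apart (π i) (a +ℤ + x) d (m<n⇒0<n∸m x<y) π∣x (subst (+ π i ∣_) y≡x+d π∣y)
  x+πi∸1≤m : x + (π i ∸ 1) ≤ m
  x+πi∸1≤m = ≤-trans (+-monoʳ-≤ x (≤-trans pred[n]≤n πi≤d))
                     (≤-trans (≤-reflexive (m+[n∸m]≡n (<⇒≤ x<y))) y≤m)
  avoids : ∀ t → 1 ≤ t → t ≤ π i ∸ 1 → ¬ (+ π i ∣ (a +ℤ + x) +ℤ + t)
  avoids t 1≤t t≤ = no-multiple-between (π i) (a +ℤ + x) t π∣x 1≤t (m≤pred[n]⇒suc[m]≤n t≤)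

large-prime-bound : ∀ n a m (π : Family (suc (suc n))) pk w →
                    Balanced (suc (suc n)) a m π → IsNthPrime (suc (suc n)) pk →
                    IsOmega (suc n) w → ∀ i → pk < π i → π i ≤ w + 1
large-prime-bound n a m π pk w (distinct , covers , _ , balanced) isPk (_ , maximal) i pk<πi
  with x , y , _ , x<y , y≤m , π∣x , π∣y , _ ← balanced pk isPk i pk<πi
  = ≤-trans (m≤n+m∸n (π i) 1) (≤-trans (+-monoʳ-≤ 1 πi∸1≤w) (≤-reflexive (+-comm 1 w)))
  where
  πi∸1≤w : π i ∸ 1 ≤ w
  πi∸1≤w = maximal (π i ∸ 1) (gap-attainable n a m π i x y distinct covers x<y y≤m π∣x π∣y)

¬¬-greatest : (P : ℕ → Set) → ∀ n → P 0 → (∀ m → P m → m ≤ n) →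
              ¬ ¬ (∃ λ w → P w × (∀ m → P m → m ≤ w))
¬¬-greatest P zero P0 bounded ¬greatest = ¬greatest (0 , P0 , bounded)
¬¬-greatest P (suc n) P0 bounded ¬greatest = ¬¬-excluded-middle (λ where
  (yes Pn+1) → ¬greatest (suc n , Pn+1 , bounded)
  (no ¬Pn+1) → ¬¬-greatest P n P0 (bounded′ ¬Pn+1) ¬greatest)
  where
  bounded′ : ¬ P (suc n) → ∀ m → P m → m ≤ n
  bounded′ ¬Pn+1 m Pm = s≤s⁻¹ (≤∧≢⇒< (bounded m Pm) (λ m≡n+1 → ¬Pn+1 (subst P m≡n+1 Pm)))

-- If Ω(k) exists, then (up to double negation) so does Ω(k−1): the length 0 is
-- attainable by deleting a prime, and Ω(k) bounds all lengths attainable with k − 2 primes.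
¬¬-omega-pred : ∀ n m → IsOmega (suc (suc n)) m → ¬ ¬ (∃ (IsOmega (suc n)))
¬¬-omega-pred n m ((a , π , distinct , _) , maximal) =
  ¬¬-greatest (Attainable (suc n)) m attainable-0 (λ m′ → maximal m′ ∘ attainable-suc n m′)
  where
  attainable-0 : Attainable (suc n) 0
  attainable-0 = a , removeAt π fzero , removeAt-distinct n π fzero distinct , λ x 1≤x x≤0 → ⊥-elim (<⇒≱ 1≤x x≤0)

proposition2 : (k : ℕ) → 3 ≤ k → (a : ℤ) → (m : ℕ) → (π : Family k) →
    Balanced k a m π → (q : ℕ) → IsQ k q → ∀ i → π i ≤ q
proposition2 k@(suc (suc (suc n))) (s≤s (s≤s (s≤s _))) a m π balanced@(distinct , _ , isΩ , _) q isQ i =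
  decidable-stable (π i ≤? q) (¬¬-map bound (¬¬-omega-pred (suc n) m isΩ))
  where
  pk = proj₁ (nthPrime k (s≤s z≤n))
  isPk = proj₂ (nthPrime k (s≤s z≤n))
  πi-prime = proj₁ (proj₂ distinct i)
  bound : ∃ (IsOmega (suc (suc n))) → π i ≤ q
  bound (w , isW) with _ , _ , maximal ← isQ pk w isPk isW | π i ≤? pk
  ... | yes πi≤pk = maximal (π i) πi-prime (inj₁ πi≤pk)
  ... | no πi≰pk = maximal (π i) πi-prime
                     (inj₂ (large-prime-bound (suc n) a m π pk w balanced isPk isW i (≰⇒> πi≰pk)))
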